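{- Let $F_v$ be a local field, $G_v=\mathbf G(F_v)$, $\overline G_v$ a degree-$n$ covering group $1\to\mu_n\to\overline G_v\to G_v\to1$, and $1\to\mu_n\to\overline{G^\square_v}\to G^{\square}_v\to1$ a covering of $G^\square_v=\mathbf G^{\square,K}(F_v)$. Suppose $\iota:\overline G_v\times\overline G_v\to\overline{G^\square_v}$ is a group homomorphism lifting the doubling homomorphism $\iota:G_v\times G_v\to G^\square_v$ and restricting on $\mu_n\times\mu_n$ to $(\zeta_1,\zeta_2)\mapsto\zeta_1^{ -1}\zeta_2$. Let $\overline{(G\times G)}_v$ be the pullback of $\overline{G^\square_v}$ along $\iota:G_v\times G_v\to G^\square_v$. Then there is a splitting (a group homomorphism section) of $\overline{(G\times G)}_v\to G_v\times G_v$ over the diagonal $G_v^{\diamondsuit}=\{(g,g):g\in G_v\}$.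
   Context: $\mathbf G$ is a classical group (unitary group of a non-degenerate $\epsilon$-skew hermitian form on a free module $W$ over a division algebra with involution, or the special orthogonal group in the orthogonal case), $K$ a positive integer, $W^{\square,K}=W_{1,+}\oplus\cdots\oplus W_{K,+}\oplus W_{K,- }\oplus\cdots\oplus W_{1,- }$ with form $\sum_i(\langle x_i,x_i'\rangle-\langle y_i,y_i'\rangle)$ and $\mathbf G^{\square,K}$ its unitary (resp. special orthogonal) group; the doubling homomorphism $\iota(g_1,g_2)$ acts by $g_1$ on all summands except $W_{1,- }$, where it acts by $g_2$. -}

module Defs where

open import Level using (Level; _⊔_) renaming (suc to lsuc)
open import Data.Product using (Σ; _×_; _,_; proj₁; proj₂)
open import Algebra.Bundles using (Group; AbelianGroup)
open import Algebra.Morphism.Structures using (module GroupMorphisms)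
import Algebra.Construct.DirectProduct as DP
import Relation.Binary.Reasoning.Setoid as SetoidReasoning

IsGroupHom : ∀ {a ℓ₁ b ℓ₂} (G : Group a ℓ₁) (H : Group b ℓ₂) →
             (Group.Carrier G → Group.Carrier H) → Set (a ⊔ ℓ₁ ⊔ ℓ₂)
IsGroupHom G H f =
  GroupMorphisms.IsGroupHomomorphism (Group.rawGroup G) (Group.rawGroup H) f

_×ᴳ_ : ∀ {c ℓ} → Group c ℓ → Group c ℓ → Group c ℓ
G ×ᴳ H = DP.group G H

record Covering {c ℓ} (M : AbelianGroup c ℓ) (G : Group c ℓ) : Set (lsuc (c ⊔ ℓ)) where
  field
    cover        : Group c ℓ
  private
    module M = AbelianGroup M
    module G = Group G
    module C = Group cover
  field
    incl         : M.Carrier → C.Carrier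
    incl-hom     : IsGroupHom M.group cover incl
    incl-inj     : ∀ {ζ ξ} → incl ζ C.≈ incl ξ → ζ M.≈ ξ
    incl-central : ∀ ζ x → (incl ζ C.∙ x) C.≈ (x C.∙ incl ζ)
    proj         : C.Carrier → G.Carrier
    proj-hom     : IsGroupHom cover G proj
    proj-surj    : ∀ g → Σ C.Carrier (λ x → proj x G.≈ g)
    proj-incl    : ∀ ζ → proj (incl ζ) G.≈ G.ε
    exact        : ∀ x → proj x G.≈ G.ε → Σ M.Carrier (λ ζ → incl ζ C.≈ x)

module _ {c ℓ} {M : AbelianGroup c ℓ} (G H : Group c ℓ) (Cv : Covering M H)
         (φ : Group.Carrier G → Group.Carrier H) (φ-hom : IsGroupHom G H φ) where
  private
    module G = Group G
    module H = Group H
    open Covering Cv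
    module C = Group cover
    module φh = GroupMorphisms.IsGroupHomomorphism φ-hom
    module ph = GroupMorphisms.IsGroupHomomorphism proj-hom
    open SetoidReasoning H.setoid

  PBCarrier : Set (c ⊔ ℓ)
  PBCarrier = Σ (G.Carrier × C.Carrier) (λ gx → φ (proj₁ gx) H.≈ proj (proj₂ gx))

  pullback : Group (c ⊔ ℓ) ℓ
  pullback = record
    { Carrier = PBCarrier
    ; _≈_ = λ u v → (proj₁ (proj₁ u) G.≈ proj₁ (proj₁ v)) × (proj₂ (proj₁ u) C.≈ proj₂ (proj₁ v))
    ; _∙_ = mul
    ; ε = (G.ε , C.ε) , eps
    ; _⁻¹ = inv
    ; isGroup = record
      { isMonoid = record
        { isSemigroup = record
          { isMagma = record
            { isEquivalence = record
              { refl = G.refl , C.refl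
              ; sym = λ (p , q) → G.sym p , C.sym q
              ; trans = λ (p , q) (p' , q') → G.trans p p' , C.trans q q' }
            ; ∙-cong = λ (p , q) (p' , q') → G.∙-cong p p' , C.∙-cong q q' }
          ; assoc = λ u v w → G.assoc _ _ _ , C.assoc _ _ _ }
        ; identity = (λ u → G.identityˡ _ , C.identityˡ _) , (λ u → G.identityʳ _ , C.identityʳ _) }
      ; inverse = (λ u → G.inverseˡ _ , C.inverseˡ _) , (λ u → G.inverseʳ _ , C.inverseʳ _)
      ; ⁻¹-cong = λ (p , q) → G.⁻¹-cong p , C.⁻¹-cong q } }
    where
    mul : PBCarrier → PBCarrier → PBCarrier
    mul ((g , x) , p) ((h , y) , q) = (g G.∙ h , x C.∙ y) , (begin
      φ (g G.∙ h)       ≈⟨ φh.homo g h ⟩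
      φ g H.∙ φ h       ≈⟨ H.∙-cong p q ⟩
      proj x H.∙ proj y ≈⟨ H.sym (ph.homo x y) ⟩
      proj (x C.∙ y)    ∎)
    eps : φ G.ε H.≈ proj C.ε
    eps = H.trans φh.ε-homo (H.sym ph.ε-homo)
    inv : PBCarrier → PBCarrier
    inv ((g , x) , p) = (g G.⁻¹ , x C.⁻¹) , (begin
      φ (g G.⁻¹)    ≈⟨ φh.⁻¹-homo g ⟩
      φ g H.⁻¹      ≈⟨ H.⁻¹-cong p ⟩
      proj x H.⁻¹   ≈⟨ H.sym (ph.⁻¹-homo x) ⟩
      proj (x C.⁻¹) ∎)

  pbProj : PBCarrier → Group.Carrier G
  pbProj u = proj₁ (proj₁ u)

{-# OPTIONS --safe #-}
-- The diagonal map x ↦ ιbar (x , x) is a homomorphism from the cover of G to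
-- the cover of G□.  On μn it is ζ ↦ ζ⁻¹ ζ = 1, so it is constant on the fibres
-- of the cover projection and descends to a homomorphism G → cover of G□;
-- since ιbar lifts ι, this homomorphism lies over g ↦ ι (g , g), which is
-- exactly a splitting of the pulled-back cover over the diagonal.
module Submission where

open import Defs
open import Data.Product using (Σ; _×_; _,_; proj₁; proj₂)
open import Function.Base using (_∘_)
open import Algebra.Morphism.Structures using (module GroupMorphisms)
open import Algebra.Bundles using (Group; AbelianGroup)
open import Algebra.Morphism.Construct.Composition using (isGroupHomomorphism)
import Relation.Binary.Reasoning.Setoid as SetoidReasoning

diagonal-isGroupHom : ∀ {c ℓ} (G : Group c ℓ) → IsGroupHom G (G ×ᴳ G) (λ g → g , g)
diagonal-isGroupHom G = record
  { isMonoidHomomorphism = record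
    { isMagmaHomomorphism = record
      { isRelHomomorphism = record { cong = λ e → e , e }
      ; homo = λ _ _ → refl , refl }
    ; ε-homo = refl , refl }
  ; ⁻¹-homo = λ _ → refl , refl }
  where open Group G

module Descent {c ℓ} {M : AbelianGroup c ℓ} {G : Group c ℓ} (Cv : Covering M G)
         {d ℓ′} (D : Group d ℓ′) {f : Group.Carrier (Covering.cover Cv) → Group.Carrier D}
         (f-hom : IsGroupHom (Covering.cover Cv) D f)
         (f-kills : ∀ ζ → Group._≈_ D (f (Covering.incl Cv ζ)) (Group.ε D)) where
  private
    open Covering Cv
    module G = Group G
    module C = Group cover
    module D = Group D
    module f = GroupMorphisms.IsGroupHomomorphism f-hom
    module p = GroupMorphisms.IsGroupHomomorphism proj-hom

  constant-on-fibres : ∀ {x y} → proj x G.≈ proj y → f x D.≈ f y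
  constant-on-fibres {x} {y} e = begin
    f x                     ≈⟨ f.⟦⟧-cong x≈y∙ζ ⟩
    f (y C.∙ incl ζ)        ≈⟨ f.homo y (incl ζ) ⟩
    f y D.∙ f (incl ζ)      ≈⟨ D.∙-congˡ (f-kills ζ) ⟩
    f y D.∙ D.ε             ≈⟨ D.identityʳ (f y) ⟩
    f y                     ∎
    where
    open SetoidReasoning D.setoid
    y⁻¹x-in-kernel : proj (y C.⁻¹ C.∙ x) G.≈ G.ε
    y⁻¹x-in-kernel = G.trans (p.homo _ _)
      (G.trans (G.∙-cong (p.⁻¹-homo y) e) (G.inverseˡ _))
    ζ : AbelianGroup.Carrier M
    ζ = proj₁ (exact _ y⁻¹x-in-kernel)
    x≈y∙ζ : x C.≈ y C.∙ incl ζ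
    x≈y∙ζ = C.sym (C.trans (C.∙-congˡ (proj₂ (exact _ y⁻¹x-in-kernel)))
      (C.trans (C.sym (C.assoc _ _ _))
      (C.trans (C.∙-congʳ (C.inverseʳ y)) (C.identityˡ x))))

  private
    lift : G.Carrier → C.Carrier
    lift g = proj₁ (proj-surj g)

    proj-lift : ∀ g → proj (lift g) G.≈ g
    proj-lift g = proj₂ (proj-surj g)

    f-lift-cong : ∀ {g x} → g G.≈ proj x → f (lift g) D.≈ f x
    f-lift-cong e = constant-on-fibres (G.trans (proj-lift _) e)

  descend : G.Carrier → D.Carrier
  descend = f ∘ lift

  descend-proj : ∀ x → descend (proj x) D.≈ f x
  descend-proj x = constant-on-fibres (proj-lift (proj x))

  descend-isGroupHom : IsGroupHom G D descend
  descend-isGroupHom = record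
    { isMonoidHomomorphism = record
      { isMagmaHomomorphism = record
        { isRelHomomorphism = record
          { cong = λ e → f-lift-cong (G.trans e (G.sym (proj-lift _))) }
        ; homo = λ g h → D.trans
            (f-lift-cong (G.sym (G.trans (p.homo _ _) (G.∙-cong (proj-lift g) (proj-lift h)))))
            (f.homo (lift g) (lift h)) }
      ; ε-homo = D.trans (f-lift-cong (G.sym p.ε-homo)) f.ε-homo }
    ; ⁻¹-homo = λ g → D.trans
        (f-lift-cong (G.sym (G.trans (p.⁻¹-homo _) (G.⁻¹-cong (proj-lift g)))))
        (f.⁻¹-homo (lift g)) }

module _ {c ℓ} {M : AbelianGroup c ℓ} (G H : Group c ℓ) (Cv : Covering M H)
         (φ : Group.Carrier G → Group.Carrier H) (φ-hom : IsGroupHom G H φ)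
         {k ℓ′} (K : Group k ℓ′)
         {a : Group.Carrier K → Group.Carrier G} (a-hom : IsGroupHom K G a)
         {b : Group.Carrier K → Group.Carrier (Covering.cover Cv)}
         (b-hom : IsGroupHom K (Covering.cover Cv) b)
         (commutes : ∀ x → Group._≈_ H (φ (a x)) (Covering.proj Cv (b x))) where
  private
    module a = GroupMorphisms.IsGroupHomomorphism a-hom
    module b = GroupMorphisms.IsGroupHomomorphism b-hom

  pullback-pair-isGroupHom : IsGroupHom K (pullback G H Cv φ φ-hom) (λ x → (a x , b x) , commutes x)
  pullback-pair-isGroupHom = record
    { isMonoidHomomorphism = record
      { isMagmaHomomorphism = record
        { isRelHomomorphism = record { cong = λ e → a.⟦⟧-cong e , b.⟦⟧-cong e }
        ; homo = λ x y → a.homo x y , b.homo x y }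
      ; ε-homo = a.ε-homo , b.ε-homo }
    ; ⁻¹-homo = λ x → a.⁻¹-homo x , b.⁻¹-homo x }

lemma8p6 : ∀ {c ℓ} (μn : AbelianGroup c ℓ) (G G□ : Group c ℓ)
    (ι : Group.Carrier (G ×ᴳ G) → Group.Carrier G□) (ι-hom : IsGroupHom (G ×ᴳ G) G□ ι)
    (Gbar : Covering μn G) (G□bar : Covering μn G□)
    (ιbar : Group.Carrier (Covering.cover Gbar ×ᴳ Covering.cover Gbar) → Group.Carrier (Covering.cover G□bar))
    (ιbar-hom : IsGroupHom (Covering.cover Gbar ×ᴳ Covering.cover Gbar) (Covering.cover G□bar) ιbar)
    (ιbar-lifts : ∀ x y → Group._≈_ G□ (Covering.proj G□bar (ιbar (x , y)))
    (ι (Covering.proj Gbar x , Covering.proj Gbar y)))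
    (ιbar-μn : ∀ ζ₁ ζ₂ → Group._≈_ (Covering.cover G□bar)
    (ιbar (Covering.incl Gbar ζ₁ , Covering.incl Gbar ζ₂))
    (Covering.incl G□bar (AbelianGroup._∙_ μn (AbelianGroup._⁻¹ μn ζ₁) ζ₂))) →
    Σ (Group.Carrier G → Group.Carrier (pullback (G ×ᴳ G) G□ G□bar ι ι-hom)) (λ s →
    IsGroupHom G (pullback (G ×ᴳ G) G□ G□bar ι ι-hom) s
    × (∀ g → Group._≈_ (G ×ᴳ G) (pbProj (G ×ᴳ G) G□ G□bar ι ι-hom (s g)) (g , g)))
lemma8p6 μn G G□ ι ι-hom Gbar G□bar ιbar ιbar-hom ιbar-lifts ιbar-μn =
  (λ g → ((g , g) , descend g) , over-ι g) ,
  pullback-pair-isGroupHom (G ×ᴳ G) G□ G□bar ι ι-hom G (diagonal-isGroupHom G)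
    descend-isGroupHom over-ι ,
  λ _ → G.refl , G.refl
  where
  module M = AbelianGroup μn
  module G = Group G
  module H = Group G□
  module Gb where
    open Covering Gbar public
    open Group cover public using (Carrier)
  module Hb where
    open Covering G□bar public
    open Group cover public
  module ι = GroupMorphisms.IsGroupHomomorphism ι-hom
  module Hb-incl = GroupMorphisms.IsGroupHomomorphism Hb.incl-hom
  module Hb-proj = GroupMorphisms.IsGroupHomomorphism Hb.proj-hom

  ιΔ-hom : IsGroupHom Gb.cover Hb.cover (λ x → ιbar (x , x))
  ιΔ-hom = isGroupHomomorphism Hb.trans (diagonal-isGroupHom Gb.cover) ιbar-hom

  ιΔ-kills-μn : ∀ ζ → ιbar (Gb.incl ζ , Gb.incl ζ) Hb.≈ Hb.ε
  ιΔ-kills-μn ζ = Hb.trans (ιbar-μn ζ ζ)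
    (Hb.trans (Hb-incl.⟦⟧-cong (M.inverseˡ ζ)) Hb-incl.ε-homo)

  open Descent Gbar Hb.cover ιΔ-hom ιΔ-kills-μn
  module descend = GroupMorphisms.IsGroupHomomorphism descend-isGroupHom

  over-ι : ∀ g → ι (g , g) H.≈ Hb.proj (descend g)
  over-ι g = begin
    ι (g , g)                     ≈⟨ ι.⟦⟧-cong (G.sym proj-x≈g , G.sym proj-x≈g) ⟩
    ι (Gb.proj x , Gb.proj x)     ≈⟨ H.sym (ιbar-lifts x x) ⟩
    Hb.proj (ιbar (x , x))        ≈⟨ Hb-proj.⟦⟧-cong (Hb.sym (descend-proj x)) ⟩
    Hb.proj (descend (Gb.proj x)) ≈⟨ Hb-proj.⟦⟧-cong (descend.⟦⟧-cong proj-x≈g) ⟩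
    Hb.proj (descend g)           ∎
    where
    open SetoidReasoning H.setoid
    x : Gb.Carrier
    x = proj₁ (Gb.proj-surj g)
    proj-x≈g : Gb.proj x G.≈ g
    proj-x≈g = proj₂ (Gb.proj-surj g)
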